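{- Let $n \geq 2$ and $d_1, d_2 \geq 1$ be integers, let $\mathcal{X}_1, \mathcal{X}_2$ be vector spaces over a field $\mathbb{F}$, and for each $a \in \{1,\dots,n\}$ let $x_{a,1} \in \mathcal{X}_1$ and $x_{a,2} \in \mathcal{X}_2$ be non-zero vectors. Suppose that for each $j \in \{1,2\}$, $$\dim \operatorname{span}\{x_{a,j} : a \in \{1,\dots,n\}\} \geq d_j.$$ If $n+1 \leq d_1 + d_2$, then $$\sum_{a=1}^{n} x_{a,1} \otimes x_{a,2} \neq 0.$$ -}

module Defs where

open import Level using (Level; _⊔_) renaming (suc to lsuc)
open import Algebra.Bundles using (CommutativeRing)
open import Algebra.Module.Bundles using (Module)
open import Data.Nat using (ℕ; zero; suc)
open import Data.Fin using (Fin; zero; suc)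
open import Data.Product using (∃; _×_)
open import Relation.Nullary using (¬_)

record IsField {c ℓ : Level} (R : CommutativeRing c ℓ) : Set (c ⊔ ℓ) where
  open CommutativeRing R
  field
    1≉0     : ¬ (1# ≈ 0#)
    inverse : ∀ x → ¬ (x ≈ 0#) → ∃ λ y → x * y ≈ 1#

record Field (c ℓ : Level) : Set (lsuc (c ⊔ ℓ)) where
  field
    commutativeRing : CommutativeRing c ℓ
    isField         : IsField commutativeRing
  open CommutativeRing commutativeRing public

VectorSpace : {c ℓ : Level} → Field c ℓ → (m ℓm : Level) → Set _
VectorSpace 𝔽 m ℓm = Module (Field.commutativeRing 𝔽) m ℓm

module _ {c ℓ m ℓm : Level} (𝔽 : Field c ℓ) (V : VectorSpace 𝔽 m ℓm) where
  open Field 𝔽 using (Carrier; _≈_; 0#)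
  open Module V

  ∑ᴹ : (n : ℕ) → (Fin n → Carrierᴹ) → Carrierᴹ
  ∑ᴹ zero    f = 0ᴹ
  ∑ᴹ (suc n) f = f zero +ᴹ ∑ᴹ n (λ a → f (suc a))

  InSpan : {n : ℕ} → (Fin n → Carrierᴹ) → Carrierᴹ → Set (c ⊔ ℓm)
  InSpan {n} x v = ∃ λ (k : Fin n → Carrier) → v ≈ᴹ ∑ᴹ n (λ a → k a *ₗ x a)

  LinearlyIndependent : {d : ℕ} → (Fin d → Carrierᴹ) → Set (c ⊔ ℓ ⊔ ℓm)
  LinearlyIndependent {d} v =
    ∀ (k : Fin d → Carrier) → ∑ᴹ d (λ i → k i *ₗ v i) ≈ᴹ 0ᴹ → ∀ i → k i ≈ 0#

  DimSpan≥ : {n : ℕ} → (Fin n → Carrierᴹ) → ℕ → Set (c ⊔ ℓ ⊔ m ⊔ ℓm)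
  DimSpan≥ x d = ∃ λ (v : Fin d → Carrierᴹ) →
    (∀ i → InSpan x (v i)) × LinearlyIndependent v

-- Tensor product X₁ ⊗_𝔽 X₂ (as an abelian group), by the standard
-- construction: the free abelian group on X₁ × X₂ (formal terms modulo the
-- abelian group laws) modulo the bilinearity relations.  Since there are
-- no quotient types, the tensor product is the setoid (Tm, _∼_).

module Tensor {c ℓ m₁ ℓ₁ m₂ ℓ₂ : Level} (𝔽 : Field c ℓ)
              (X₁ : VectorSpace 𝔽 m₁ ℓ₁) (X₂ : VectorSpace 𝔽 m₂ ℓ₂) where
  open Field 𝔽 using (Carrier)
  open Module X₁ renaming (Carrierᴹ to V₁; _≈ᴹ_ to _≈₁_; _+ᴹ_ to _+₁_; _*ₗ_ to _*₁_)
  open Module X₂ renaming (Carrierᴹ to V₂; _≈ᴹ_ to _≈₂_; _+ᴹ_ to _+₂_; _*ₗ_ to _*₂_)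

  infixl 6 _⊕_
  infix  7 _⊗_
  infix  4 _∼_

  data Tm : Set (m₁ ⊔ m₂) where
    _⊗_ : V₁ → V₂ → Tm
    𝟎   : Tm
    _⊕_ : Tm → Tm → Tm
    ⊝_  : Tm → Tm

  data _∼_ : Tm → Tm → Set (c ⊔ m₁ ⊔ m₂ ⊔ ℓ₁ ⊔ ℓ₂) where
    ∼-refl   : ∀ {s} → s ∼ s
    ∼-sym    : ∀ {s t} → s ∼ t → t ∼ s
    ∼-trans  : ∀ {s t u} → s ∼ t → t ∼ u → s ∼ u
    ⊕-cong   : ∀ {s s' t t'} → s ∼ s' → t ∼ t' → s ⊕ t ∼ s' ⊕ t'
    ⊝-cong   : ∀ {s t} → s ∼ t → ⊝ s ∼ ⊝ t
    ⊗-cong   : ∀ {x x' y y'} → x ≈₁ x' → y ≈₂ y' → x ⊗ y ∼ x' ⊗ y'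
    ⊕-assoc     : ∀ s t u → (s ⊕ t) ⊕ u ∼ s ⊕ (t ⊕ u)
    ⊕-comm      : ∀ s t → s ⊕ t ∼ t ⊕ s
    ⊕-identityˡ : ∀ s → 𝟎 ⊕ s ∼ s
    ⊕-inverseˡ  : ∀ s → (⊝ s) ⊕ s ∼ 𝟎
    ⊗-distribʳ : ∀ x x' y → (x +₁ x') ⊗ y ∼ x ⊗ y ⊕ x' ⊗ y
    ⊗-distribˡ : ∀ x y y' → x ⊗ (y +₂ y') ∼ x ⊗ y ⊕ x ⊗ y'
    ⊗-scalar   : ∀ (k : Carrier) x y → (k *₁ x) ⊗ y ∼ x ⊗ (k *₂ y)

  ∑ᵀ : (n : ℕ) → (Fin n → Tm) → Tm
  ∑ᵀ zero    f = 𝟎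
  ∑ᵀ (suc n) f = f zero ⊕ ∑ᵀ n (λ a → f (suc a))

module Submission where

-- Proof of Proposition 5.  Given a derivation  D : ∑ₐ x₁ a ⊗ x₂ a ∼ 0,  we
-- show d₁ + d₂ ≤ n, contradicting n + 1 ≤ d₁ + d₂.
--  * D mentions finitely many vectors of X₂; extend the independent family
--    w_j = ∑ₐ l j a · x₂ a to an independent family B spanning all of them.
--  * For a coordinate functional φ of B, the contraction x ⊗ y ↦ φ(y) · x
--    into X₁ respects every rule of D, so ∑ₐ φ(x₂ a) · x₁ a = 0.  Taking for
--    φ the coordinate at w_j gives rows u_j ∈ 𝔽ⁿ with ∑ₐ u j a · x₁ a = 0
--    and the duality ⟨l i , u j⟩ = δ j i.
--  * With the rows k_i of the independent v_i = ∑ₐ k i a · x₁ a this gives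
--    d₁ + d₂ independent rows in 𝔽ⁿ, so d₁ + d₂ ≤ n by the Steinitz bound.
-- Equality in 𝔽 and membership in a span are undecidable, so the argument
-- runs in the double-negation monad; the decidable conclusion d₁ + d₂ ≤ n is
-- stable.

open import Defs
open import Level using (Level; _⊔_) renaming (suc to lsuc)
open import Algebra.Bundles using (CommutativeMonoid)
open import Algebra.Module.Bundles using (Module)
import Algebra.Module.Construct.TensorUnit as TensorUnit
import Algebra.Properties.CommutativeSemigroup as CommutativeSemigroupProperties
import Algebra.Properties.Group as GroupProperties
import Algebra.Properties.Ring as RingProperties
open import Data.Empty using (⊥-elim)
open import Data.Nat as ℕ using (ℕ; zero; suc; _≤_; _≤?_; z≤n; s≤s)
open import Data.Nat.Properties using (m≤n⇒m≤1+n; m+1+n≰m; ≤-trans)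
open import Data.Fin using (Fin; zero; suc; punchIn; _↑ˡ_; _↑ʳ_; splitAt; join; _≟_)
open import Data.Fin.Properties using (suc-injective; join-splitAt)
open import Data.List using (List; []; _∷_; _++_; tabulate)
open import Data.List.Relation.Unary.All as All using (All; []; _∷_)
open import Data.List.Relation.Unary.All.Properties using (++⁻; tabulate⁻)
open import Data.Product using (Σ; ∃; _×_; _,_; proj₁; proj₂)
open import Data.Sum using ([_,_])
open import Data.Vec.Functional using (insertAt) renaming (_∷_ to _◂_; _++_ to _++ᵛ_)
open import Data.Vec.Functional.Properties
  using (insertAt-lookup; insertAt-punchIn; lookup-++ˡ; lookup-++ʳ)
open import Function using (_∘_)
open import Relation.Binary.PropositionalEquality as ≡ using (_≡_)
open import Relation.Nullary using (¬_; Dec; yes; no)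
open import Relation.Nullary.Decidable using (decidable-stable; ¬¬-excluded-middle)
open import Relation.Nullary.Negation using (¬¬-map)

module _ {a b} {A : Set a} {B : Set b} where
  infixl 1 _>>=_
  _>>=_ : ¬ ¬ A → (A → ¬ ¬ B) → ¬ ¬ B
  (m >>= f) k = m (λ x → f x k)

return : ∀ {a} {A : Set a} → A → ¬ ¬ A
return x k = k x

¬¬-zipWith : ∀ {a b c} {A : Set a} {B : Set b} {C : Set c} →
             (A → B → C) → ¬ ¬ A → ¬ ¬ B → ¬ ¬ C
¬¬-zipWith f ¬¬a ¬¬b = ¬¬a >>= λ a → ¬¬-map (f a) ¬¬b

¬¬-∀Fin : ∀ {p} n {P : Fin n → Set p} → (∀ i → ¬ ¬ P i) → ¬ ¬ (∀ i → P i)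
¬¬-∀Fin zero    h k = k (λ ())
¬¬-∀Fin (suc n) {P} h =
  h zero >>= λ p₀ → ¬¬-∀Fin n (h ∘ suc) >>= λ ps → return (cases p₀ ps)
  where
  cases : P zero → (∀ i → P (suc i)) → ∀ i → P i
  cases p₀ ps zero    = p₀
  cases p₀ ps (suc i) = ps i

∀-↑ : ∀ {p} {m n} {P : Fin (m ℕ.+ n) → Set p} →
      (∀ i → P (i ↑ˡ n)) → (∀ j → P (m ↑ʳ j)) → ∀ i → P i
∀-↑ {m = m} {n} {P} left right i =
  ≡.subst P (join-splitAt m n i) ([_,_] {C = P ∘ join m n} left right (splitAt m i))

module Kronecker {c ℓ : Level} (𝔽 : Field c ℓ) where
  open Field 𝔽 using (Carrier; _≈_; 0#; 1#; refl; sym; trans)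

  δ : ∀ {q} → Fin q → Fin q → Carrier
  δ zero    zero    = 1#
  δ zero    (suc _) = 0#
  δ (suc _) zero    = 0#
  δ (suc i) (suc j) = δ i j

  δ-diag : ∀ {q} (i : Fin q) → δ i i ≈ 1#
  δ-diag zero    = refl
  δ-diag (suc i) = δ-diag i

  δ-off : ∀ {q} (i j : Fin q) → ¬ i ≡ j → δ i j ≈ 0#
  δ-off zero    zero    i≢j = ⊥-elim (i≢j ≡.refl)
  δ-off zero    (suc j) i≢j = refl
  δ-off (suc i) zero    i≢j = refl
  δ-off (suc i) (suc j) i≢j = δ-off i j (i≢j ∘ ≡.cong suc)

  δ-reindex : ∀ {p q} (f : Fin p → Fin q) → (∀ i j → f i ≡ f j → i ≡ j) →
              ∀ i j → δ (f i) (f j) ≈ δ i j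
  δ-reindex f f-inj i j with i ≟ j
  ... | yes ≡.refl = trans (δ-diag (f i)) (sym (δ-diag i))
  ... | no  i≢j    = trans (δ-off (f i) (f j) (i≢j ∘ f-inj i j)) (sym (δ-off i j i≢j))

𝔽-space : ∀ {c ℓ} (𝔽 : Field c ℓ) → VectorSpace 𝔽 c ℓ
𝔽-space 𝔽 = TensorUnit.⟨module⟩ {R = Field.commutativeRing 𝔽}

module Sums {c ℓ m ℓm : Level} (𝔽 : Field c ℓ) (M : VectorSpace 𝔽 m ℓm) where
  open Field 𝔽 using (Carrier; _+_; _*_)
  open Module M
  open Kronecker 𝔽 using (δ)
  open CommutativeSemigroupProperties
    (CommutativeMonoid.commutativeSemigroup +ᴹ-commutativeMonoid)
    using (interchange; x∙yz≈y∙xz)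
  open import Relation.Binary.Reasoning.Setoid ≈ᴹ-setoid

  ∑ : (n : ℕ) → (Fin n → Carrierᴹ) → Carrierᴹ
  ∑ = ∑ᴹ 𝔽 M

  ∑ˢ : (n : ℕ) → (Fin n → Carrier) → Carrier
  ∑ˢ = ∑ᴹ 𝔽 (𝔽-space 𝔽)

  lincomb : ∀ {n} → (Fin n → Carrier) → (Fin n → Carrierᴹ) → Carrierᴹ
  lincomb {n} k x = ∑ n (λ i → k i *ₗ x i)

  ∑-cong : ∀ n {f g : Fin n → Carrierᴹ} → (∀ i → f i ≈ᴹ g i) → ∑ n f ≈ᴹ ∑ n g
  ∑-cong zero    f≈g = ≈ᴹ-refl
  ∑-cong (suc n) f≈g = +ᴹ-cong (f≈g zero) (∑-cong n (f≈g ∘ suc))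

  ∑-zero : ∀ n {f : Fin n → Carrierᴹ} → (∀ i → f i ≈ᴹ 0ᴹ) → ∑ n f ≈ᴹ 0ᴹ
  ∑-zero zero    f≈0 = ≈ᴹ-refl
  ∑-zero (suc n) f≈0 = ≈ᴹ-trans (+ᴹ-cong (f≈0 zero) (∑-zero n (f≈0 ∘ suc))) (+ᴹ-identityˡ 0ᴹ)

  ∑-+ : ∀ n (f g : Fin n → Carrierᴹ) → ∑ n (λ i → f i +ᴹ g i) ≈ᴹ ∑ n f +ᴹ ∑ n g
  ∑-+ zero    f g = ≈ᴹ-sym (+ᴹ-identityˡ 0ᴹ)
  ∑-+ (suc n) f g = ≈ᴹ-trans (+ᴹ-congˡ (∑-+ n (f ∘ suc) (g ∘ suc)))
                             (interchange (f zero) (g zero) _ _)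

  ∑-*ₗ : ∀ n k (f : Fin n → Carrierᴹ) → ∑ n (λ i → k *ₗ f i) ≈ᴹ k *ₗ ∑ n f
  ∑-*ₗ zero    k f = ≈ᴹ-sym (*ₗ-zeroʳ k)
  ∑-*ₗ (suc n) k f = ≈ᴹ-trans (+ᴹ-congˡ (∑-*ₗ n k (f ∘ suc)))
                              (≈ᴹ-sym (*ₗ-distribˡ k (f zero) _))

  ∑ˢ-*ₗ : ∀ n (k : Fin n → Carrier) v → ∑ˢ n k *ₗ v ≈ᴹ ∑ n (λ i → k i *ₗ v)
  ∑ˢ-*ₗ zero    k v = *ₗ-zeroˡ v
  ∑ˢ-*ₗ (suc n) k v = ≈ᴹ-trans (*ₗ-distribʳ v (k zero) _) (+ᴹ-congˡ (∑ˢ-*ₗ n (k ∘ suc) v))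

  ∑-swap : ∀ n p (f : Fin n → Fin p → Carrierᴹ) →
           ∑ n (λ i → ∑ p (f i)) ≈ᴹ ∑ p (λ j → ∑ n (λ i → f i j))
  ∑-swap zero    p f = ≈ᴹ-sym (∑-zero p (λ _ → ≈ᴹ-refl))
  ∑-swap (suc n) p f = ≈ᴹ-trans (+ᴹ-congˡ (∑-swap n p (f ∘ suc))) (≈ᴹ-sym (∑-+ p (f zero) _))

  ∑-punchIn : ∀ n (i : Fin (suc n)) (f : Fin (suc n) → Carrierᴹ) →
              ∑ (suc n) f ≈ᴹ f i +ᴹ ∑ n (f ∘ punchIn i)
  ∑-punchIn n       zero    f = ≈ᴹ-refl
  ∑-punchIn (suc n) (suc i) f = ≈ᴹ-trans (+ᴹ-congˡ (∑-punchIn n i (f ∘ suc)))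
                                         (x∙yz≈y∙xz (f zero) (f (suc i)) _)

  ∑-↑ : ∀ m n (f : Fin (m ℕ.+ n) → Carrierᴹ) →
        ∑ (m ℕ.+ n) f ≈ᴹ ∑ m (λ i → f (i ↑ˡ n)) +ᴹ ∑ n (λ j → f (m ↑ʳ j))
  ∑-↑ zero    n f = ≈ᴹ-sym (+ᴹ-identityˡ _)
  ∑-↑ (suc m) n f = ≈ᴹ-trans (+ᴹ-congˡ (∑-↑ m n (f ∘ suc))) (≈ᴹ-sym (+ᴹ-assoc _ _ _))

  ∑-δ : ∀ q (t : Fin q) (f : Fin q → Carrierᴹ) → ∑ q (λ b → δ b t *ₗ f b) ≈ᴹ f t
  ∑-δ (suc q) zero    f = ≈ᴹ-trans (+ᴹ-cong (*ₗ-identityˡ (f zero))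
                                            (∑-zero q (λ b → *ₗ-zeroˡ (f (suc b)))))
                                   (+ᴹ-identityʳ (f zero))
  ∑-δ (suc q) (suc t) f = ≈ᴹ-trans (+ᴹ-cong (*ₗ-zeroˡ (f zero)) (∑-δ q t (f ∘ suc)))
                                   (+ᴹ-identityˡ (f (suc t)))

  lincomb-+ : ∀ {n} (a b : Fin n → Carrier) (x : Fin n → Carrierᴹ) →
              lincomb (λ i → a i + b i) x ≈ᴹ lincomb a x +ᴹ lincomb b x
  lincomb-+ {n} a b x = ≈ᴹ-trans (∑-cong n (λ i → *ₗ-distribʳ (x i) (a i) (b i))) (∑-+ n _ _)

  lincomb-* : ∀ {n} k (a : Fin n → Carrier) (x : Fin n → Carrierᴹ) →
              lincomb (λ i → k * a i) x ≈ᴹ k *ₗ lincomb a x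
  lincomb-* {n} k a x = ≈ᴹ-trans (∑-cong n (λ i → *ₗ-assoc k (a i) (x i))) (∑-*ₗ n k _)

  lincomb-lincomb : ∀ {n p} (c : Fin p → Carrier) (f : Fin p → Fin n → Carrier)
                    (x : Fin n → Carrierᴹ) →
                    lincomb (λ a → ∑ˢ p (λ i → c i * f i a)) x ≈ᴹ
                    lincomb c (λ i → lincomb (f i) x)
  lincomb-lincomb {n} {p} c f x = begin
    ∑ n (λ a → ∑ˢ p (λ i → c i * f i a) *ₗ x a)
      ≈⟨ ∑-cong n (λ a → ∑ˢ-*ₗ p (λ i → c i * f i a) (x a)) ⟩
    ∑ n (λ a → ∑ p (λ i → (c i * f i a) *ₗ x a))
      ≈⟨ ∑-cong n (λ a → ∑-cong p (λ i → *ₗ-assoc (c i) (f i a) (x a))) ⟩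
    ∑ n (λ a → ∑ p (λ i → c i *ₗ (f i a *ₗ x a)))
      ≈⟨ ∑-swap n p _ ⟩
    ∑ p (λ i → ∑ n (λ a → c i *ₗ (f i a *ₗ x a)))
      ≈⟨ ∑-cong p (λ i → ∑-*ₗ n (c i) _) ⟩
    ∑ p (λ i → c i *ₗ lincomb (f i) x) ∎

module Independence {c ℓ m ℓm : Level} (𝔽 : Field c ℓ) (M : VectorSpace 𝔽 m ℓm) where
  open Field 𝔽 using (Carrier; _≈_; _+_; _*_; -_; 0#; 1#)
  private module F = Field 𝔽
  open IsField (Field.isField 𝔽)
  open Module M
  open Sums 𝔽 M
  open GroupProperties +ᴹ-group using (∙-cancelʳ)
  open import Relation.Binary.Reasoning.Setoid ≈ᴹ-setoid

  WeaklyIndependent : ∀ {d} → (Fin d → Carrierᴹ) → Set (c ⊔ ℓ ⊔ ℓm)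
  WeaklyIndependent v =
    ∀ k → ¬ ¬ (lincomb k v ≈ᴹ 0ᴹ) → ∀ i → ¬ ¬ (k i ≈ 0#)

  independent⇒weakly : ∀ {d} {v : Fin d → Carrierᴹ} →
                       LinearlyIndependent 𝔽 M v → WeaklyIndependent v
  independent⇒weakly ind k k≈0 i = ¬¬-map (λ k≈0 → ind k k≈0 i) k≈0

  module _ {q} {B : Fin q → Carrierᴹ} where
    span-◂ : ∀ z {y} → InSpan 𝔽 M B y → InSpan 𝔽 M (z ◂ B) y
    span-◂ z (k , y≈) = (0# ◂ k) ,
      ≈ᴹ-trans y≈ (≈ᴹ-sym (≈ᴹ-trans (+ᴹ-congʳ (*ₗ-zeroˡ z)) (+ᴹ-identityˡ _)))

    span-head : ∀ z → InSpan 𝔽 M (z ◂ B) z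
    span-head z = (1# ◂ λ _ → 0#) ,
      ≈ᴹ-sym (≈ᴹ-trans (+ᴹ-cong (*ₗ-identityˡ z) (∑-zero q (λ b → *ₗ-zeroˡ (B b))))
                       (+ᴹ-identityʳ z))

    -- A vector outside the span of an independent family may be added to it:
    -- in a relation k₀ z + S = 0 an invertible k₀ would put z into the span,
    -- so k₀ = 0, and then S = 0 forces the remaining coefficients to vanish.
    independent-◂ : ∀ z → WeaklyIndependent B → ¬ InSpan 𝔽 M B z →
                    WeaklyIndependent (z ◂ B)
    independent-◂ z indB z∉B k rel = coefficient
      where
      S : Carrierᴹ
      S = lincomb (k ∘ suc) B

      head-zero : ¬ ¬ (k zero ≈ 0#)
      head-zero k₀≉0 with inverse (k zero) k₀≉0
      ... | y , k₀y≈1 = rel λ rel → z∉B ((λ b → (- y) * k (suc b)) , z-in-span rel)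
        where
        z-in-span : k zero *ₗ z +ᴹ S ≈ᴹ 0ᴹ → z ≈ᴹ lincomb (λ b → (- y) * k (suc b)) B
        z-in-span rel = begin
          z                  ≈⟨ ≈ᴹ-sym (*ₗ-identityˡ z) ⟩
          1# *ₗ z            ≈⟨ *ₗ-congʳ (F.sym (F.trans (F.*-comm y (k zero)) k₀y≈1)) ⟩
          (y * k zero) *ₗ z  ≈⟨ *ₗ-assoc y (k zero) z ⟩
          y *ₗ (k zero *ₗ z) ≈⟨ ∙-cancelʳ (y *ₗ S) _ _ cancel ⟩
          (- y) *ₗ S         ≈⟨ ≈ᴹ-sym (lincomb-* (- y) (k ∘ suc) B) ⟩
          lincomb (λ b → (- y) * k (suc b)) B ∎
          where
          cancel : y *ₗ (k zero *ₗ z) +ᴹ y *ₗ S ≈ᴹ (- y) *ₗ S +ᴹ y *ₗ S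
          cancel = begin
            y *ₗ (k zero *ₗ z) +ᴹ y *ₗ S ≈⟨ ≈ᴹ-sym (*ₗ-distribˡ y _ S) ⟩
            y *ₗ (k zero *ₗ z +ᴹ S)      ≈⟨ *ₗ-congˡ rel ⟩
            y *ₗ 0ᴹ                      ≈⟨ *ₗ-zeroʳ y ⟩
            0ᴹ                           ≈⟨ ≈ᴹ-sym (*ₗ-zeroˡ S) ⟩
            0# *ₗ S                      ≈⟨ *ₗ-congʳ (F.sym (F.-‿inverseˡ y)) ⟩
            (- y + y) *ₗ S               ≈⟨ *ₗ-distribʳ S (- y) y ⟩
            (- y) *ₗ S +ᴹ y *ₗ S ∎

      tail-relation : ¬ ¬ (S ≈ᴹ 0ᴹ)
      tail-relation = head-zero >>= λ k₀≈0 → ¬¬-map (λ rel → begin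
        S                ≈⟨ ≈ᴹ-sym (+ᴹ-identityˡ S) ⟩
        0ᴹ +ᴹ S          ≈⟨ +ᴹ-congʳ (≈ᴹ-sym (≈ᴹ-trans (*ₗ-congʳ k₀≈0) (*ₗ-zeroˡ z))) ⟩
        k zero *ₗ z +ᴹ S ≈⟨ rel ⟩
        0ᴹ ∎) rel

      coefficient : ∀ i → ¬ ¬ (k i ≈ 0#)
      coefficient zero    = head-zero
      coefficient (suc i) = indB (k ∘ suc) tail-relation i

  record Extension {d : ℕ} (w : Fin d → Carrierᴹ) : Set (c ⊔ ℓ ⊔ m ⊔ ℓm) where
    field
      size        : ℕ
      B           : Fin size → Carrierᴹ
      ι           : Fin d → Fin size
      B∘ι         : ∀ j → B (ι j) ≡ w j
      ι-injective : ∀ i j → ι i ≡ ι j → i ≡ j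
      independent : WeaklyIndependent B

  trivial-extension : ∀ {d} {w : Fin d → Carrierᴹ} → LinearlyIndependent 𝔽 M w → Extension w
  trivial-extension {d} {w} ind = record
    { size = d ; B = w ; ι = λ j → j ; B∘ι = λ j → ≡.refl
    ; ι-injective = λ i j i≡j → i≡j ; independent = independent⇒weakly ind }

  -- Up to double negation, an independent family can be extended so that
  -- its span contains any given finite list of vectors: each vector either
  -- lies in the span already or is added to the family.
  extend : ∀ {d} {w : Fin d → Carrierᴹ} (zs : List Carrierᴹ) → Extension w →
           ¬ ¬ (Σ (Extension w) λ e → All (InSpan 𝔽 M (Extension.B e)) zs)
  extend []       e = return (e , [])
  extend {w = w} (z ∷ zs) e =
    extend zs e >>= λ (e′ , zs∈e′) → ¬¬-excluded-middle >>= λ z∈e′? →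
    return (add-z e′ zs∈e′ z∈e′?)
    where
    add-z : (e′ : Extension w) → All (InSpan 𝔽 M (Extension.B e′)) zs →
            Dec (InSpan 𝔽 M (Extension.B e′) z) →
            Σ (Extension w) λ e → All (InSpan 𝔽 M (Extension.B e)) (z ∷ zs)
    add-z e′ zs∈e′ (yes z∈e′) = e′ , z∈e′ ∷ zs∈e′
    add-z e′ zs∈e′ (no  z∉e′) = record
      { size = suc size ; B = z ◂ B ; ι = suc ∘ ι ; B∘ι = B∘ι
      ; ι-injective = λ i j ιi≡ιj → ι-injective i j (suc-injective ιi≡ιj)
      ; independent = independent-◂ z independent z∉e′ }
      , span-head z ∷ All.map (span-◂ z) zs∈e′
      where open Extension e′

  -- A linear functional M → 𝔽 that need only be defined on part of M: a
  -- relation y ↦ a ("φ(y) = a") whose values are unique up to double negation.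
  record PartialFunctional (ℓφ : Level) : Set (c ⊔ ℓ ⊔ m ⊔ ℓm ⊔ lsuc ℓφ) where
    infix 4 _↦_
    field
      _↦_         : Carrierᴹ → Carrier → Set ℓφ
      functional  : ∀ {y a a′} → y ↦ a → y ↦ a′ → ¬ ¬ (a ≈ a′)
      respects    : ∀ {y y′ a a′} → y ≈ᴹ y′ → ¬ ¬ (a ≈ a′) → y ↦ a → y′ ↦ a′
      additive    : ∀ {y y′ a a′} → y ↦ a → y′ ↦ a′ → y +ᴹ y′ ↦ a + a′
      homogeneous : ∀ k {y a} → y ↦ a → k *ₗ y ↦ k * a

  -- The t-th coordinate with respect to a weakly independent family B,
  -- defined on span B; uniqueness of values is the independence of B.
  coordinate : ∀ {q} (B : Fin q → Carrierᴹ) → WeaklyIndependent B → Fin q →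
               PartialFunctional (c ⊔ ℓ ⊔ ℓm)
  coordinate {q} B indB t = record
    { _↦_         = _↦_
    ; functional  = functional
    ; respects    = λ y≈y′ a≈a′ (r , y≈ , a≈) →
        r , ≈ᴹ-trans (≈ᴹ-sym y≈y′) y≈ , (a≈a′ >>= λ a≈a′ → ¬¬-map (F.trans (F.sym a≈a′)) a≈)
    ; additive    = λ (r , y≈ , a≈) (r′ , y′≈ , a′≈) → (λ b → r b + r′ b) ,
        ≈ᴹ-trans (+ᴹ-cong y≈ y′≈) (≈ᴹ-sym (lincomb-+ r r′ B)) ,
        (a≈ >>= λ a≈ → ¬¬-map (F.+-cong a≈) a′≈)
    ; homogeneous = λ k (r , y≈ , a≈) → (λ b → k * r b) ,
        ≈ᴹ-trans (*ₗ-congˡ y≈) (≈ᴹ-sym (lincomb-* k r B)) , ¬¬-map F.*-congˡ a≈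
    }
    where
    _↦_ : Carrierᴹ → Carrier → Set (c ⊔ ℓ ⊔ ℓm)
    y ↦ a = Σ (Fin q → Carrier) λ r → (y ≈ᴹ lincomb r B) × ¬ ¬ (a ≈ r t)

    -- two expansions of y differ by a relation among the B's
    functional : ∀ {y a a′} → y ↦ a → y ↦ a′ → ¬ ¬ (a ≈ a′)
    functional (r , y≈ , a≈) (r′ , y≈′ , a≈′) =
      indB (λ b → r b + - r′ b) (return difference) t >>= λ rt-r′t≈0 →
      a≈ >>= λ a≈ → a≈′ >>= λ a≈′ →
      return (F.trans a≈ (F.trans (x∙y⁻¹≈ε⇒x≈y (r t) (r′ t) rt-r′t≈0) (F.sym a≈′)))
      where
      open GroupProperties F.+-group using (x∙y⁻¹≈ε⇒x≈y)
      -r′ : Carrierᴹ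
      -r′ = lincomb (λ b → - r′ b) B
      difference : lincomb (λ b → r b + - r′ b) B ≈ᴹ 0ᴹ
      difference = begin
        lincomb (λ b → r b + - r′ b) B      ≈⟨ lincomb-+ r (λ b → - r′ b) B ⟩
        lincomb r B +ᴹ -r′                  ≈⟨ +ᴹ-congʳ (≈ᴹ-trans (≈ᴹ-sym y≈) y≈′) ⟩
        lincomb r′ B +ᴹ -r′                 ≈⟨ +ᴹ-comm _ -r′ ⟩
        -r′ +ᴹ lincomb r′ B                 ≈⟨ ≈ᴹ-sym (lincomb-+ (λ b → - r′ b) r′ B) ⟩
        lincomb (λ b → - r′ b + r′ b) B     ≈⟨ ∑-zero q (λ b → ≈ᴹ-trans
                                                 (*ₗ-congʳ (F.-‿inverseˡ (r′ b))) (*ₗ-zeroˡ (B b))) ⟩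
        0ᴹ ∎

  coordinate-of : ∀ {q} {B : Fin q → Carrierᴹ} (indB : WeaklyIndependent B) t {y} r →
                  y ≈ᴹ lincomb r B → PartialFunctional._↦_ (coordinate B indB t) y (r t)
  coordinate-of indB t r y≈ = r , y≈ , return F.refl

module Factors {c ℓ m₁ ℓ₁ m₂ ℓ₂ : Level} (𝔽 : Field c ℓ)
               (X₁ : VectorSpace 𝔽 m₁ ℓ₁) (X₂ : VectorSpace 𝔽 m₂ ℓ₂) where
  open Tensor 𝔽 X₁ X₂
  open Module X₂ using (Carrierᴹ)

  factors : Tm → List Carrierᴹ
  factors (x ⊗ y) = y ∷ []
  factors 𝟎       = []
  factors (s ⊕ t) = factors s ++ factors t
  factors (⊝ s)   = factors s

  -- the second factors of the middle terms of all transitivity steps in a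
  -- derivation: the only terms a derivation introduces beyond its endpoints
  factors-of : ∀ {s t} → s ∼ t → List Carrierᴹ
  factors-of (∼-sym D)               = factors-of D
  factors-of (∼-trans {t = t} D₁ D₂) = factors t ++ (factors-of D₁ ++ factors-of D₂)
  factors-of (⊕-cong D₁ D₂)          = factors-of D₁ ++ factors-of D₂
  factors-of (⊝-cong D)              = factors-of D
  factors-of _                       = []

-- For a partial functional φ on X₂, the contraction  x ⊗ y ↦ φ(y) · x  is a
-- partial map X₁ ⊗ X₂ → X₁, defined (as a relation) on the terms all of whose
-- second factors lie in the domain of φ, and respecting ∼.
module Contraction {c ℓ m₁ ℓ₁ m₂ ℓ₂ ℓφ : Level} (𝔽 : Field c ℓ)
  (X₁ : VectorSpace 𝔽 m₁ ℓ₁) (X₂ : VectorSpace 𝔽 m₂ ℓ₂)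
  (φ : Independence.PartialFunctional 𝔽 X₂ ℓφ) where
  private module F = Field 𝔽
  private module Y = Module X₂
  open Tensor 𝔽 X₁ X₂
  open Factors 𝔽 X₁ X₂
  open Module X₁
  open Sums 𝔽 X₁ using (∑; lincomb)
  open Independence.PartialFunctional φ
  open import Relation.Binary.Reasoning.Setoid ≈ᴹ-setoid

  _≈ʷ_ : Carrierᴹ → Carrierᴹ → Set ℓ₁
  X ≈ʷ X′ = ¬ ¬ (X ≈ᴹ X′)

  data Ev : Tm → Carrierᴹ → Set (c ⊔ m₁ ⊔ m₂ ⊔ ℓφ) where
    ev⊗ : ∀ {x y} a → y ↦ a → Ev (x ⊗ y) (a *ₗ x)
    ev𝟎 : Ev 𝟎 0ᴹ
    ev⊕ : ∀ {s t A B} → Ev s A → Ev t B → Ev (s ⊕ t) (A +ᴹ B)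
    ev⊝ : ∀ {s A} → Ev s A → Ev (⊝ s) (-ᴹ A)

  Defined : Y.Carrierᴹ → Set (c ⊔ ℓφ)
  Defined y = ∃ (y ↦_)

  ev-total : ∀ t → All Defined (factors t) → ∃ (Ev t)
  ev-total (x ⊗ y) ((a , y↦a) ∷ []) = a *ₗ x , ev⊗ a y↦a
  ev-total 𝟎       _ = 0ᴹ , ev𝟎
  ev-total (s ⊕ t) defined with ++⁻ (factors s) defined
  ... | defined-s , defined-t with ev-total s defined-s | ev-total t defined-t
  ... | A , ev-s | B , ev-t = A +ᴹ B , ev⊕ ev-s ev-t
  ev-total (⊝ s)   defined with ev-total s defined
  ... | A , ev-s = -ᴹ A , ev⊝ ev-s

  ev-unique : ∀ {t X X′} → Ev t X → Ev t X′ → X ≈ʷ X′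
  ev-unique (ev⊗ a y↦a) (ev⊗ a′ y↦a′) = ¬¬-map *ₗ-congʳ (functional y↦a y↦a′)
  ev-unique ev𝟎         ev𝟎           = return ≈ᴹ-refl
  ev-unique (ev⊕ eA eB) (ev⊕ eA′ eB′) = ¬¬-zipWith +ᴹ-cong (ev-unique eA eA′) (ev-unique eB eB′)
  ev-unique (ev⊝ eA)    (ev⊝ eA′)     = ¬¬-map -ᴹ‿cong (ev-unique eA eA′)

  ev-⊗-distribʳ : ∀ {x x′ y X Y} → Ev ((x +ᴹ x′) ⊗ y) X → Ev (x ⊗ y ⊕ x′ ⊗ y) Y → X ≈ʷ Y
  ev-⊗-distribʳ {x} {x′} (ev⊗ a y↦a) (ev⊕ (ev⊗ a₁ y↦a₁) (ev⊗ a₂ y↦a₂)) =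
    ¬¬-zipWith (λ a≈a₁ a≈a₂ → begin
      a *ₗ (x +ᴹ x′)     ≈⟨ *ₗ-distribˡ a x x′ ⟩
      a *ₗ x +ᴹ a *ₗ x′  ≈⟨ +ᴹ-cong (*ₗ-congʳ a≈a₁) (*ₗ-congʳ a≈a₂) ⟩
      a₁ *ₗ x +ᴹ a₂ *ₗ x′ ∎)
      (functional y↦a y↦a₁) (functional y↦a y↦a₂)

  ev-⊗-distribˡ : ∀ {x y y′ X Y} → Ev (x ⊗ (y Y.+ᴹ y′)) X → Ev (x ⊗ y ⊕ x ⊗ y′) Y → X ≈ʷ Y
  ev-⊗-distribˡ {x} (ev⊗ a y↦a) (ev⊕ (ev⊗ a₁ y↦a₁) (ev⊗ a₂ y↦a₂)) =
    ¬¬-map (λ a≈a₁+a₂ → ≈ᴹ-trans (*ₗ-congʳ a≈a₁+a₂) (*ₗ-distribʳ x a₁ a₂))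
           (functional y↦a (additive y↦a₁ y↦a₂))

  ev-⊗-scalar : ∀ k {x y X Y} → Ev ((k *ₗ x) ⊗ y) X → Ev (x ⊗ (k Y.*ₗ y)) Y → X ≈ʷ Y
  ev-⊗-scalar k {x} (ev⊗ a y↦a) (ev⊗ a′ ky↦a′) =
    ¬¬-map (λ ka≈a′ → begin
      a *ₗ (k *ₗ x)  ≈⟨ ≈ᴹ-sym (*ₗ-assoc a k x) ⟩
      (a F.* k) *ₗ x ≈⟨ *ₗ-congʳ (F.trans (F.*-comm a k) ka≈a′) ⟩
      a′ *ₗ x ∎)
      (functional (homogeneous k y↦a) ky↦a′)

  ev-⊗-cong : ∀ {x x′ y y′ X Y} → x ≈ᴹ x′ → y Y.≈ᴹ y′ → Ev (x ⊗ y) X → Ev (x′ ⊗ y′) Y → X ≈ʷ Y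
  ev-⊗-cong x≈x′ y≈y′ (ev⊗ a y↦a) (ev⊗ a′ y′↦a′) =
    ¬¬-map (λ a≈a′ → *ₗ-cong a≈a′ x≈x′)
           (functional (respects y≈y′ (return F.refl) y↦a) y′↦a′)

  ev-⊕-assoc : ∀ {s t u X Y} → Ev ((s ⊕ t) ⊕ u) X → Ev (s ⊕ (t ⊕ u)) Y → X ≈ʷ Y
  ev-⊕-assoc (ev⊕ (ev⊕ eA eB) eC) (ev⊕ eA′ (ev⊕ eB′ eC′)) =
    ev-unique eA eA′ >>= λ A≈A′ →
    ¬¬-zipWith (λ B≈B′ C≈C′ → ≈ᴹ-trans (+ᴹ-assoc _ _ _) (+ᴹ-cong A≈A′ (+ᴹ-cong B≈B′ C≈C′)))
               (ev-unique eB eB′) (ev-unique eC eC′)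

  ev-⊕-comm : ∀ {s t X Y} → Ev (s ⊕ t) X → Ev (t ⊕ s) Y → X ≈ʷ Y
  ev-⊕-comm (ev⊕ eA eB) (ev⊕ eB′ eA′) =
    ¬¬-zipWith (λ A≈A′ B≈B′ → ≈ᴹ-trans (+ᴹ-comm _ _) (+ᴹ-cong B≈B′ A≈A′))
               (ev-unique eA eA′) (ev-unique eB eB′)

  ev-⊕-identityˡ : ∀ {s X Y} → Ev (𝟎 ⊕ s) X → Ev s Y → X ≈ʷ Y
  ev-⊕-identityˡ (ev⊕ ev𝟎 eA) eA′ = ¬¬-map (≈ᴹ-trans (+ᴹ-identityˡ _)) (ev-unique eA eA′)

  ev-⊕-inverseˡ : ∀ {s X Y} → Ev (⊝ s ⊕ s) X → Ev 𝟎 Y → X ≈ʷ Y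
  ev-⊕-inverseˡ (ev⊕ (ev⊝ eA) eA′) ev𝟎 =
    ¬¬-map (λ A≈A′ → ≈ᴹ-trans (+ᴹ-congʳ (-ᴹ‿cong A≈A′)) (-ᴹ‿inverseˡ _)) (ev-unique eA eA′)

  ev-invariant : ∀ {s t} (D : s ∼ t) → All Defined (factors-of D) →
                 ∀ {X Y} → Ev s X → Ev t Y → X ≈ʷ Y
  ev-invariant ∼-refl _ eX eY = ev-unique eX eY
  ev-invariant (∼-sym D) defined eX eY = ¬¬-map ≈ᴹ-sym (ev-invariant D defined eY eX)
  ev-invariant (∼-trans {t = t} D₁ D₂) defined eX eY with ++⁻ (factors t) defined
  ... | defined-t , defined-D with ++⁻ (factors-of D₁) defined-D | ev-total t defined-t
  ... | defined₁ , defined₂ | Z , eZ =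
    ¬¬-zipWith ≈ᴹ-trans (ev-invariant D₁ defined₁ eX eZ) (ev-invariant D₂ defined₂ eZ eY)
  ev-invariant (⊕-cong D₁ D₂) defined (ev⊕ eA eB) (ev⊕ eA′ eB′) with ++⁻ (factors-of D₁) defined
  ... | defined₁ , defined₂ =
    ¬¬-zipWith +ᴹ-cong (ev-invariant D₁ defined₁ eA eA′) (ev-invariant D₂ defined₂ eB eB′)
  ev-invariant (⊝-cong D) defined (ev⊝ eA) (ev⊝ eA′) =
    ¬¬-map -ᴹ‿cong (ev-invariant D defined eA eA′)
  ev-invariant (⊗-cong x≈x′ y≈y′) _ = ev-⊗-cong x≈x′ y≈y′
  ev-invariant (⊕-assoc _ _ _)     _ = ev-⊕-assoc
  ev-invariant (⊕-comm _ _)        _ = ev-⊕-comm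
  ev-invariant (⊕-identityˡ _)     _ = ev-⊕-identityˡ
  ev-invariant (⊕-inverseˡ _)      _ = ev-⊕-inverseˡ
  ev-invariant (⊗-distribʳ _ _ _)  _ = ev-⊗-distribʳ
  ev-invariant (⊗-distribˡ _ _ _)  _ = ev-⊗-distribˡ
  ev-invariant (⊗-scalar k _ _)    _ = ev-⊗-scalar k

  ev-∑ : ∀ n {T : Fin n → Tm} {X : Fin n → Carrierᴹ} →
         (∀ a → Ev (T a) (X a)) → Ev (∑ᵀ n T) (∑ n X)
  ev-∑ zero    ev = ev𝟎
  ev-∑ (suc n) ev = ev⊕ (ev zero) (ev-∑ n (ev ∘ suc))

  contract : ∀ {n} (x₁ : Fin n → Carrierᴹ) (x₂ : Fin n → Y.Carrierᴹ)
             (D : ∑ᵀ n (λ a → x₁ a ⊗ x₂ a) ∼ 𝟎) → All Defined (factors-of D) →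
             (c : Fin n → F.Carrier) → (∀ a → x₂ a ↦ c a) → lincomb c x₁ ≈ʷ 0ᴹ
  contract {n} x₁ x₂ D defined c x₂↦c =
    ev-invariant D defined (ev-∑ n (λ a → ev⊗ (c a) (x₂↦c a))) ev𝟎

module Rows {c ℓ : Level} (𝔽 : Field c ℓ) where
  open Field 𝔽 hiding (zero)
  open IsField isField
  open RingProperties ring using (-‿distribˡ-*; -‿distribʳ-*)
  open Sums 𝔽 (𝔽-space 𝔽) using (∑; ∑-cong; ∑-zero; ∑-+; ∑-*ₗ; ∑-punchIn)
  open import Relation.Binary.Reasoning.Setoid setoid

  IndependentRows : ∀ m n → (Fin m → Fin n → Carrier) → Set (c ⊔ ℓ)
  IndependentRows m n v = ∀ (k : Fin m → Carrier) →
    (∀ r → ¬ ¬ (∑ m (λ i → k i * v i r) ≈ 0#)) → ∀ i → ¬ ¬ (k i ≈ 0#)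

  drop-first-column : ∀ {m n} (v : Fin m → Fin (suc n) → Carrier) →
                      ¬ (∃ λ i → ¬ v i zero ≈ 0#) →
                      IndependentRows m (suc n) v → IndependentRows m n (λ i r → v i (suc r))
  drop-first-column {m} v no-pivot ind k rel = ind k rel′
    where
    rel′ : ∀ r → ¬ ¬ (∑ m (λ i → k i * v i r) ≈ 0#)
    rel′ zero    = ¬¬-map (λ column≈0 → ∑-zero m (λ i → trans (*-congˡ (column≈0 i)) (zeroʳ (k i))))
                          (¬¬-∀Fin m (λ i v≉0 → no-pivot (i , v≉0)))
    rel′ (suc r) = rel r

  reduce : ∀ {m n} → (Fin (suc m) → Fin (suc n) → Carrier) → Fin (suc m) → Carrier →
           Fin m → Fin n → Carrier
  reduce v i₀ y j r = v (punchIn i₀ j) (suc r) - (v (punchIn i₀ j) zero * y) * v i₀ (suc r)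

  -- The reduced rows stay independent: a relation k among them lifts to the
  -- relation K among the rows of v that gives row i₀ the coefficient - s.
  reduce-independent : ∀ {m n} (v : Fin (suc m) → Fin (suc n) → Carrier) i₀ y →
                       v i₀ zero * y ≈ 1# →
                       IndependentRows (suc m) (suc n) v → IndependentRows m n (reduce v i₀ y)
  reduce-independent {m} v i₀ y pivot·y≈1 ind k rel j =
    ¬¬-map (trans (reflexive (≡.sym (insertAt-punchIn k i₀ (- s) j))))
           (ind K lifted-rel (punchIn i₀ j))
    where
    s : Carrier
    s = ∑ m (λ j → k j * (v (punchIn i₀ j) zero * y))
    K : Fin (suc m) → Carrier
    K = insertAt k i₀ (- s)

    K-column : ∀ r → ∑ (suc m) (λ i → K i * v i r) ≈
                     (- s) * v i₀ r + ∑ m (λ j → k j * v (punchIn i₀ j) r)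
    K-column r = trans (∑-punchIn m i₀ (λ i → K i * v i r))
      (+-cong (*-congʳ (reflexive (insertAt-lookup k i₀ (- s))))
              (∑-cong m (λ j → *-congʳ (reflexive (insertAt-punchIn k i₀ (- s) j)))))

    -- s was chosen so that K kills the pivot column
    s·pivot : s * v i₀ zero ≈ ∑ m (λ j → k j * v (punchIn i₀ j) zero)
    s·pivot = begin
      s * c₀                                          ≈⟨ *-comm s c₀ ⟩
      c₀ * s                                          ≈⟨ sym (∑-*ₗ m c₀ _) ⟩
      ∑ m (λ j → c₀ * (k j * (v (punchIn i₀ j) zero * y))) ≈⟨ ∑-cong m (λ j → cancel (k j) _) ⟩
      ∑ m (λ j → k j * v (punchIn i₀ j) zero) ∎
      where
      c₀ : Carrier
      c₀ = v i₀ zero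
      cancel : ∀ a b → c₀ * (a * (b * y)) ≈ a * b
      cancel a b = begin
        c₀ * (a * (b * y)) ≈⟨ *-congˡ (sym (*-assoc a b y)) ⟩
        c₀ * ((a * b) * y) ≈⟨ *-comm c₀ _ ⟩
        ((a * b) * y) * c₀ ≈⟨ *-assoc (a * b) y c₀ ⟩
        (a * b) * (y * c₀) ≈⟨ *-congˡ (trans (*-comm y c₀) pivot·y≈1) ⟩
        (a * b) * 1#       ≈⟨ *-identityʳ (a * b) ⟩
        a * b ∎

    K-reduced : ∀ r → ∑ (suc m) (λ i → K i * v i (suc r)) ≈ ∑ m (λ j → k j * reduce v i₀ y j r)
    K-reduced r = begin
      ∑ (suc m) (λ i → K i * v i (suc r)) ≈⟨ K-column (suc r) ⟩
      (- s) * w + A                       ≈⟨ +-comm _ A ⟩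
      A + (- s) * w                       ≈⟨ +-congˡ (trans (sym (-‿distribˡ-* s w))
                                                (trans (-‿cong (*-comm s w)) (-‿distribˡ-* w s))) ⟩
      A + (- w) * s                       ≈⟨ +-congˡ (sym (∑-*ₗ m (- w) _)) ⟩
      A + ∑ m (λ j → (- w) * (k j * (v (punchIn i₀ j) zero * y))) ≈⟨ sym (∑-+ m _ _) ⟩
      ∑ m (λ j → k j * v (punchIn i₀ j) (suc r) + (- w) * (k j * (v (punchIn i₀ j) zero * y)))
        ≈⟨ ∑-cong m (λ j → sym (expand (k j) (v (punchIn i₀ j) (suc r)) (v (punchIn i₀ j) zero * y))) ⟩
      ∑ m (λ j → k j * reduce v i₀ y j r) ∎
      where
      w A : Carrier
      w = v i₀ (suc r)
      A = ∑ m (λ j → k j * v (punchIn i₀ j) (suc r))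
      expand : ∀ a b c → a * (b - c * w) ≈ a * b + (- w) * (a * c)
      expand a b c = begin
        a * (b - c * w)         ≈⟨ distribˡ a b (- (c * w)) ⟩
        a * b + a * - (c * w)   ≈⟨ +-congˡ (sym (-‿distribʳ-* a (c * w))) ⟩
        a * b + - (a * (c * w)) ≈⟨ +-congˡ (-‿cong (trans (sym (*-assoc a c w)) (*-comm (a * c) w))) ⟩
        a * b + - (w * (a * c)) ≈⟨ +-congˡ (-‿distribˡ-* w (a * c)) ⟩
        a * b + (- w) * (a * c) ∎

    lifted-rel : ∀ r → ¬ ¬ (∑ (suc m) (λ i → K i * v i r) ≈ 0#)
    lifted-rel zero    = return (begin
      ∑ (suc m) (λ i → K i * v i zero) ≈⟨ K-column zero ⟩
      (- s) * v i₀ zero + T            ≈⟨ +-congʳ (trans (sym (-‿distribˡ-* s _)) (-‿cong s·pivot)) ⟩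
      - T + T                          ≈⟨ -‿inverseˡ T ⟩
      0# ∎)
      where
      T : Carrier
      T = ∑ m (λ j → k j * v (punchIn i₀ j) zero)
    lifted-rel (suc r) = ¬¬-map (trans (K-reduced r)) (rel r)

  -- Steinitz: m independent rows of length n force m ≤ n, by induction on n,
  -- dropping a zero first column or eliminating along a pivot in it.
  steinitz : ∀ m n (v : Fin m → Fin n → Carrier) → IndependentRows m n v → ¬ ¬ (m ≤ n)
  steinitz zero    n       v ind = return z≤n
  steinitz (suc m) zero    v ind = λ _ → ind (λ _ → 1#) (λ ()) zero 1≉0
  steinitz (suc m) (suc n) v ind = ¬¬-excluded-middle >>= by-pivot
    where
    by-pivot : Dec (∃ λ i → ¬ v i zero ≈ 0#) → ¬ ¬ (suc m ≤ suc n)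
    by-pivot (no no-pivot) =
      ¬¬-map m≤n⇒m≤1+n (steinitz (suc m) n (λ i r → v i (suc r)) (drop-first-column v no-pivot ind))
    by-pivot (yes (i₀ , pivot≉0)) with inverse (v i₀ zero) pivot≉0
    ... | y , pivot·y≈1 = ¬¬-map s≤s (steinitz m n _ (reduce-independent v i₀ y pivot·y≈1 ind))

module RowIndependence {c ℓ : Level} (𝔽 : Field c ℓ) where
  open Field 𝔽 hiding (zero)
  open Kronecker 𝔽 using (δ)
  open Rows 𝔽 using (IndependentRows)
  open Sums 𝔽 (𝔽-space 𝔽) using (∑; ∑-cong; ∑-zero; ∑-↑; ∑-δ; lincomb-lincomb)
  open import Relation.Binary.Reasoning.Setoid setoid

  -- Rows with a left dual family (⟨l i , u j⟩ = δ j i) are independent: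
  -- pairing a relation ∑ⱼ μ j · u j = 0 with l i isolates μ i.
  dual⇒independent : ∀ {n d} (u l : Fin d → Fin n → Carrier) →
                     (∀ i j → ¬ ¬ (∑ n (λ a → l i a * u j a) ≈ δ j i)) →
                     IndependentRows d n u
  dual⇒independent {n} {d} u l dual μ rel i =
    ¬¬-∀Fin n rel >>= λ rel → ¬¬-∀Fin d (λ j → dual i j) >>= λ dual → return (begin
      μ i                                                ≈⟨ sym (∑-δ d i μ) ⟩
      ∑ d (λ j → δ j i * μ j)                            ≈⟨ ∑-cong d (λ j → *-comm (δ j i) (μ j)) ⟩
      ∑ d (λ j → μ j * δ j i)                            ≈⟨ ∑-cong d (λ j → *-congˡ (sym (dual j))) ⟩
      ∑ d (λ j → μ j * ∑ n (λ a → l i a * u j a))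
        ≈⟨ ∑-cong d (λ j → *-congˡ (∑-cong n (λ a → *-comm (l i a) (u j a)))) ⟩
      ∑ d (λ j → μ j * ∑ n (λ a → u j a * l i a))        ≈⟨ sym (lincomb-lincomb μ u (l i)) ⟩
      ∑ n (λ a → ∑ d (λ j → μ j * u j a) * l i a)
        ≈⟨ ∑-zero n (λ a → trans (*-congʳ (rel a)) (zeroˡ (l i a))) ⟩
      0# ∎)

  ++-independent : ∀ {n d₁ d₂} (k : Fin d₁ → Fin n → Carrier) (u : Fin d₂ → Fin n → Carrier) →
    (∀ (κ : Fin d₁ → Carrier) (μ : Fin d₂ → Carrier) →
      (∀ a → ¬ ¬ (∑ d₁ (λ i → κ i * k i a) + ∑ d₂ (λ j → μ j * u j a) ≈ 0#)) →
      ∀ i → ¬ ¬ (κ i ≈ 0#)) →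
    IndependentRows d₂ n u → IndependentRows (d₁ ℕ.+ d₂) n (k ++ᵛ u)
  ++-independent {n} {d₁} {d₂} k u k-part u-independent ν rel =
    ∀-↑ {P = λ i → ¬ ¬ (ν i ≈ 0#)} κ≈0 μ≈0
    where
    κ : Fin d₁ → Carrier
    κ i = ν (i ↑ˡ d₂)
    μ : Fin d₂ → Carrier
    μ j = ν (d₁ ↑ʳ j)
    K U : Fin n → Carrier
    K a = ∑ d₁ (λ i → κ i * k i a)
    U a = ∑ d₂ (λ j → μ j * u j a)

    split : ∀ a → ∑ (d₁ ℕ.+ d₂) (λ i → ν i * (k ++ᵛ u) i a) ≈ K a + U a
    split a = trans (∑-↑ d₁ d₂ _)
      (+-cong (∑-cong d₁ (λ i → *-congˡ (reflexive (≡.cong (λ f → f a) (lookup-++ˡ k u i)))))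
              (∑-cong d₂ (λ j → *-congˡ (reflexive (≡.cong (λ f → f a) (lookup-++ʳ k u j))))))

    K+U≈0 : ∀ a → ¬ ¬ (K a + U a ≈ 0#)
    K+U≈0 a = ¬¬-map (trans (sym (split a))) (rel a)

    κ≈0 : ∀ i → ¬ ¬ (κ i ≈ 0#)
    κ≈0 = k-part κ μ K+U≈0

    U≈0 : ∀ a → ¬ ¬ (U a ≈ 0#)
    U≈0 a = ¬¬-∀Fin d₁ κ≈0 >>= λ κ≈0 → ¬¬-map (λ K+U≈0 → begin
      U a        ≈⟨ sym (+-identityˡ (U a)) ⟩
      0# + U a   ≈⟨ +-congʳ (sym (∑-zero d₁ (λ i → trans (*-congʳ (κ≈0 i)) (zeroˡ (k i a))))) ⟩
      K a + U a  ≈⟨ K+U≈0 ⟩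
      0# ∎) (K+U≈0 a)

    μ≈0 : ∀ j → ¬ ¬ (μ j ≈ 0#)
    μ≈0 = u-independent μ U≈0

module Annihilation {c ℓ m ℓm : Level} (𝔽 : Field c ℓ) (M : VectorSpace 𝔽 m ℓm) where
  open Field 𝔽 using (Carrier; _≈_; _+_; _*_; 0#)
  open Module M
  open Sums 𝔽 M
  open Independence 𝔽 M using (independent⇒weakly)
  open import Relation.Binary.Reasoning.Setoid ≈ᴹ-setoid

  -- Let v i = ∑ₐ k i a · x a be independent vectors of M and ∑ₐ u j a · x a = 0.
  -- Then in a relation among the rows k_i, u_j the coefficients of the k_i
  -- vanish: applied to x, the relation becomes a relation among the v i.
  annihilated-rows : ∀ {n d₁ d₂} (x : Fin n → Carrierᴹ) (v : Fin d₁ → Carrierᴹ)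
    (k : Fin d₁ → Fin n → Carrier) →
    LinearlyIndependent 𝔽 M v → (∀ i → v i ≈ᴹ lincomb (k i) x) →
    (u : Fin d₂ → Fin n → Carrier) → (∀ j → ¬ ¬ (lincomb (u j) x ≈ᴹ 0ᴹ)) →
    ∀ (κ : Fin d₁ → Carrier) (μ : Fin d₂ → Carrier) →
    (∀ a → ¬ ¬ (∑ˢ d₁ (λ i → κ i * k i a) + ∑ˢ d₂ (λ j → μ j * u j a) ≈ 0#)) →
    ∀ i → ¬ ¬ (κ i ≈ 0#)
  annihilated-rows {n} {d₁} {d₂} x v k v-independent v≈kx u ux≈0 κ μ rel =
    independent⇒weakly v-independent κ κv≈0
    where
    K U : Fin n → Carrier
    K a = ∑ˢ d₁ (λ i → κ i * k i a)
    U a = ∑ˢ d₂ (λ j → μ j * u j a)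

    Kx≈κv : lincomb K x ≈ᴹ lincomb κ v
    Kx≈κv = ≈ᴹ-trans (lincomb-lincomb κ k x) (∑-cong d₁ (λ i → *ₗ-congˡ (≈ᴹ-sym (v≈kx i))))

    Ux≈0 : ¬ ¬ (lincomb U x ≈ᴹ 0ᴹ)
    Ux≈0 = ¬¬-map (λ ux≈0 → ≈ᴹ-trans (lincomb-lincomb μ u x)
                     (∑-zero d₂ (λ j → ≈ᴹ-trans (*ₗ-congˡ (ux≈0 j)) (*ₗ-zeroʳ (μ j)))))
                  (¬¬-∀Fin d₂ ux≈0)

    [K+U]x≈0 : ¬ ¬ (lincomb (λ a → K a + U a) x ≈ᴹ 0ᴹ)
    [K+U]x≈0 = ¬¬-map (λ rel → ∑-zero n (λ a → ≈ᴹ-trans (*ₗ-congʳ (rel a)) (*ₗ-zeroˡ (x a))))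
                      (¬¬-∀Fin n rel)

    κv≈0 : ¬ ¬ (lincomb κ v ≈ᴹ 0ᴹ)
    κv≈0 = ¬¬-zipWith (λ Ux≈0 [K+U]x≈0 → begin
      lincomb κ v                          ≈⟨ ≈ᴹ-sym Kx≈κv ⟩
      lincomb K x                          ≈⟨ ≈ᴹ-sym (+ᴹ-identityʳ _) ⟩
      lincomb K x +ᴹ 0ᴹ                    ≈⟨ +ᴹ-congˡ (≈ᴹ-sym Ux≈0) ⟩
      lincomb K x +ᴹ lincomb U x           ≈⟨ ≈ᴹ-sym (lincomb-+ K U x) ⟩
      lincomb (λ a → K a + U a) x          ≈⟨ [K+U]x≈0 ⟩
      0ᴹ ∎) Ux≈0 [K+U]x≈0

module TensorRank {c ℓ m₁ ℓ₁ m₂ ℓ₂ : Level} (𝔽 : Field c ℓ)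
  (X₁ : VectorSpace 𝔽 m₁ ℓ₁) (X₂ : VectorSpace 𝔽 m₂ ℓ₂) {n d₁ d₂ : ℕ}
  (x₁ : Fin n → Module.Carrierᴹ X₁) (x₂ : Fin n → Module.Carrierᴹ X₂)
  (dim₁ : DimSpan≥ 𝔽 X₁ x₁ d₁) (dim₂ : DimSpan≥ 𝔽 X₂ x₂ d₂)
  (D : Tensor._∼_ 𝔽 X₁ X₂
         (Tensor.∑ᵀ 𝔽 X₁ X₂ n (λ a → Tensor._⊗_ {𝔽 = 𝔽} {X₁ = X₁} {X₂ = X₂} (x₁ a) (x₂ a)))
         (Tensor.𝟎 {𝔽 = 𝔽} {X₁ = X₁} {X₂ = X₂}))
  where
  open Field 𝔽 using (Carrier; _≈_; _*_; trans)
  open Kronecker 𝔽 using (δ; δ-reindex)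
  open Factors 𝔽 X₁ X₂ using (factors-of)
  open Independence 𝔽 X₂
    using (Extension; trivial-extension; extend; coordinate; coordinate-of; module PartialFunctional)
  open Rows 𝔽 using (IndependentRows; steinitz)
  open RowIndependence 𝔽 using (dual⇒independent; ++-independent)
  open Annihilation 𝔽 X₁ using (annihilated-rows)
  open Module X₂
  open Sums 𝔽 X₂ using (∑ˢ; lincomb; lincomb-lincomb; ∑-cong; ∑-δ)
  open import Relation.Binary.Reasoning.Setoid ≈ᴹ-setoid

  v : Fin d₁ → Module.Carrierᴹ X₁
  v = proj₁ dim₁
  k : Fin d₁ → Fin n → Carrier
  k i = proj₁ (proj₁ (proj₂ dim₁) i)
  w : Fin d₂ → Carrierᴹ
  w = proj₁ dim₂
  l : Fin d₂ → Fin n → Carrier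
  l i = proj₁ (proj₁ (proj₂ dim₂) i)

  relevant : List Carrierᴹ
  relevant = tabulate x₂ ++ factors-of D

  module _ (e : Extension w) (covered : All (InSpan 𝔽 X₂ (Extension.B e)) relevant) where
    open Extension e

    x₂∈span : ∀ a → InSpan 𝔽 X₂ B (x₂ a)
    x₂∈span = tabulate⁻ (proj₁ (++⁻ (tabulate x₂) covered))

    -- x₂ a = ∑_b r a b · B b, and u j a is the coordinate of x₂ a at w j
    r : Fin n → Fin size → Carrier
    r a = proj₁ (x₂∈span a)
    u : Fin d₂ → Fin n → Carrier
    u j a = r a (ι j)

    -- contraction along the coordinate of w j kills ∑ₐ x₁ a ⊗ x₂ a
    u-annihilates : ∀ j → ¬ ¬ (Module._≈ᴹ_ X₁ (Sums.lincomb 𝔽 X₁ (u j) x₁) (Module.0ᴹ X₁))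
    u-annihilates j =
      contract x₁ x₂ D (All.map (λ (r , y≈) → r (ι j) , coordinate-of independent (ι j) r y≈)
                                (proj₂ (++⁻ (tabulate x₂) covered)))
               (u j) (λ a → coordinate-of independent (ι j) (r a) (proj₂ (x₂∈span a)))
      where open Contraction 𝔽 X₁ X₂ (coordinate B independent (ι j)) using (contract)

    -- ⟨l i , u j⟩ = δ j i: both are the coordinate of w i at w j
    dual : ∀ i j → ¬ ¬ (∑ˢ n (λ a → l i a * u j a) ≈ δ j i)
    dual i j = ¬¬-map (λ ⟨l,u⟩≈ → trans ⟨l,u⟩≈ (δ-reindex ι ι-injective j i))
                      (functional via-x₂ via-B)
      where
      open PartialFunctional (coordinate B independent (ι j))
      via-x₂ : w i ↦ ∑ˢ n (λ a → l i a * u j a)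
      via-x₂ = coordinate-of independent (ι j) (λ b → ∑ˢ n (λ a → l i a * r a b)) (begin
        w i                                      ≈⟨ proj₂ (proj₁ (proj₂ dim₂) i) ⟩
        lincomb (l i) x₂                         ≈⟨ ∑-cong n (λ a → *ₗ-congˡ (proj₂ (x₂∈span a))) ⟩
        lincomb (l i) (λ a → lincomb (r a) B)    ≈⟨ ≈ᴹ-sym (lincomb-lincomb (l i) r B) ⟩
        lincomb (λ b → ∑ˢ n (λ a → l i a * r a b)) B ∎)
      via-B : w i ↦ δ (ι j) (ι i)
      via-B = coordinate-of independent (ι j) (λ b → δ b (ι i))
                (≈ᴹ-trans (≈ᴹ-reflexive (≡.sym (B∘ι i))) (≈ᴹ-sym (∑-δ size (ι i) B)))

    rows-independent : IndependentRows (d₁ ℕ.+ d₂) n (k ++ᵛ u)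
    rows-independent = ++-independent k u
      (annihilated-rows x₁ v k (proj₂ (proj₂ dim₁)) (proj₂ ∘ proj₁ (proj₂ dim₁)) u u-annihilates)
      (dual⇒independent u l dual)

  rank-bound : ¬ ¬ (d₁ ℕ.+ d₂ ≤ n)
  rank-bound = extend relevant (trivial-extension (proj₂ (proj₂ dim₂))) >>= λ (e , covered) →
               steinitz (d₁ ℕ.+ d₂) n _ (rows-independent e covered)

-- natural-number addition, only needed in the statement below (in the modules
-- above, _+_ is the field's)
open import Data.Nat using (_+_)

proposition5 : {c ℓ m₁ ℓ₁ m₂ ℓ₂ : Level} (𝔽 : Field c ℓ)
    (X₁ : VectorSpace 𝔽 m₁ ℓ₁) (X₂ : VectorSpace 𝔽 m₂ ℓ₂)
    (n d₁ d₂ : ℕ) → 2 ≤ n → 1 ≤ d₁ → 1 ≤ d₂ →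
    (x₁ : Fin n → Module.Carrierᴹ X₁) (x₂ : Fin n → Module.Carrierᴹ X₂) →
    (∀ a → ¬ (Module._≈ᴹ_ X₁ (x₁ a) (Module.0ᴹ X₁))) →
    (∀ a → ¬ (Module._≈ᴹ_ X₂ (x₂ a) (Module.0ᴹ X₂))) →
    DimSpan≥ 𝔽 X₁ x₁ d₁ → DimSpan≥ 𝔽 X₂ x₂ d₂ →
    n + 1 ≤ d₁ + d₂ →
    ¬ (Tensor._∼_ 𝔽 X₁ X₂ (Tensor.∑ᵀ 𝔽 X₁ X₂ n (λ a → Tensor._⊗_ {𝔽 = 𝔽} {X₁ = X₁} {X₂ = X₂} (x₁ a) (x₂ a))) (Tensor.𝟎 {𝔽 = 𝔽} {X₁ = X₁} {X₂ = X₂}))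
proposition5 𝔽 X₁ X₂ n d₁ d₂ _ _ _ x₁ x₂ _ _ dim₁ dim₂ n+1≤d₁+d₂ D =
  m+1+n≰m n (≤-trans n+1≤d₁+d₂ d₁+d₂≤n)
  where
  d₁+d₂≤n : d₁ + d₂ ≤ n
  d₁+d₂≤n = decidable-stable (d₁ + d₂ ≤? n) (TensorRank.rank-bound 𝔽 X₁ X₂ x₁ x₂ dim₁ dim₂ D)
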